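{- Let $r\geq2$ and $1\leq i\leq r$ be integers, let $\lambda$ be a partition and $x_\lambda$ its associated monomial. Then $x_\lambda\notin I_{r,i}$ (i.e. $x_\lambda$ is a monomial of $\mathbf{K}[x_1,x_2,\dots]/I_{r,i}$) if and only if $\lambda\in\mathcal{D}_{r,i}$. Equivalently, $\mathcal{C}_{r,i}=\mathcal{D}_{r,i}$.
   Context: $\mathbf{K}$ is a field of characteristic $0$ and $\mathbf{K}[x_1,x_2,\dots]$ the polynomial ring in countably many variables, $x_j$ of weight $j$. To a partition $\lambda=(\lambda_1,\dots,\lambda_s)$ (non-increasing sequence of positive integers) is associated the monomial $x_\lambda=x_{\lambda_1}\cdots x_{\lambda_s}$. The ideal $I_{r,i}$ is generated by $x_1^i$ and all monomials $x_{n_{1,1}}\,(x_{n_{2,1}}\cdots x_{n_{2,f(2)}})\,(x_{n_{3,1}}\cdots x_{n_{3,f(3)}})\cdots(x_{n_{r,1}}\cdots x_{n_{r,f(r)}})$ (the $j$-th parenthesized group is the $j$-th block) where the positive integers satisfy $n_{1,1}\le n_{2,1}\le\dots\le n_{2,f(2)}\le n_{3,1}\le\dots\le n_{r,f(r)}$ and $f(1)=1$, $f(j)=n_{j-1,f(j-1)}$ for $2\le j\le i$, $f(j)=n_{j-1,f(j-1)}-1$ for $i+1\le j\le r$ (if some $f(j)=0$, block $j$ and all later blocks are empty). For $\lambda=(\lambda_1,\dots,\lambda_s)$ with $\lambda_j:=0$ for $j\le0$, define for $1\le\ell\le r-1$: $p_{i,1}(\lambda)=\lambda_s$; $p_{i,\ell}(\lambda)=\lambda_{s-\sum_{j<\ell}p_{i,j}(\lambda)}$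 if $2\le\ell\le i$; $p_{i,\ell}(\lambda)=\lambda_{s+\ell-i-\sum_{j<\ell}p_{i,j}(\lambda)}$ if $i<\ell\le r-1$; if $p_{i,\ell}(\lambda)=0$ then $p_{i,j}(\lambda)=0$ for $j>\ell$. $N_{r,i}(\lambda)$ is the number of nonzero $p_{i,\ell}(\lambda)$. $\mathcal{C}_{r,i}$ is the set of partitions with at most $i-1$ parts equal to $1$ and with either $N_{r,i}(\lambda)<r-1$, or $N_{r,i}(\lambda)=r-1$ and $s\le\sum_{j=1}^{r-1}p_{i,j}(\lambda)-(r-i)$. For a partition $\mu=(\mu_1,\dots,\mu_t)$ let $\mathrm{sq}(\mu)=\max\{d\ge0:d\le t,\ \mu_d\ge d\}$ and $\mathrm{rect}(\mu)=\max\{h\ge0:h\le t,\ \mu_h\ge h+1\}$. $\mathcal{D}_{r,i}$ is the set of partitions $\lambda$ such that, with $\mu^{(0)}=\lambda$ and $\mu^{(j)}$ equal to $\mu^{(j-1)}$ with its first $c_j$ parts deleted, where $c_j=\mathrm{rect}(\mu^{(j-1)})$ for $j\le r-i$ and $c_j=\mathrm{sq}(\mu^{(j-1)})$ for $j>r-i$, the partition $\mu^{(r-1)}$ is empty. -}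

module Defs where

open import Data.Nat using (ℕ; zero; suc; _+_; _∸_; _≤_; _<_; _≤?_; _≤ᵇ_; _≡ᵇ_)
open import Data.Bool using (Bool; true; false; if_then_else_)
open import Data.List using (List; []; _∷_; length; drop; replicate; concat; _++_; filterᵇ)
open import Data.Nat.ListAction using (sum)
open import Data.List.Relation.Unary.All using (All)
open import Data.List.Relation.Unary.Linked using (Linked)
open import Data.List.Relation.Binary.Permutation.Propositional using (_↭_)
open import Data.Product using (Σ; _×_; ∃-syntax)
open import Data.Sum using (_⊎_)
open import Data.Unit using (⊤)
open import Relation.Nullary using (yes; no; ¬_)
open import Relation.Nullary.Decidable using (⌊_⌋)
open import Relation.Binary.PropositionalEquality using (_≡_)

-- A monomial x_{a₁} ⋯ x_{aₖ} of K[x₁,x₂,…] is represented by the list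
-- of its variable indices (a multiset; order is irrelevant, see _∣ₘ_).
-- A partition is a non-increasing list of positive integers; its
-- associated monomial x_λ is the list λ itself.

IsPartition : List ℕ → Set
IsPartition λ′ = Linked (λ a b → b ≤ a) λ′ × All (λ a → 0 < a) λ′

_∣ₘ_ : List ℕ → List ℕ → Set
μ ∣ₘ ν = ∃[ ρ ] (μ ++ ρ ↭ ν)

last0 : ℕ → List ℕ → ℕ
last0 p []       = p
last0 p (x ∷ xs) = last0 x xs

lastOr0 : List ℕ → ℕ
lastOr0 = last0 0

-- size f(j) of block j, given p = n_{j-1,f(j-1)} (last entry of block j-1,
-- or 0 if block j-1 is empty):  f(j) = p  if j ≤ i,  p - 1  if j > i.
fsize : (i j p : ℕ) → ℕ
fsize i j p with j ≤? i
... | yes _ = p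
... | no  _ = p ∸ 1

-- ValidBlocks i j p bs : the list bs consists of the blocks j, j+1, …,
-- with the right sizes, where p is the last entry of block j-1.
ValidBlocks : (i j p : ℕ) → List (List ℕ) → Set
ValidBlocks i j p []       = ⊤
ValidBlocks i j p (b ∷ bs) = (length b ≡ fsize i j p) × ValidBlocks i (suc j) (lastOr0 b) bs

IsBlockGenerator : (r i : ℕ) → List (List ℕ) → Set
IsBlockGenerator r i bs =
  Σ ℕ λ n → Σ (List (List ℕ)) λ rest →
    (bs ≡ (n ∷ []) ∷ rest) × (length rest ≡ r ∸ 1) × ValidBlocks i 2 n rest
    × Linked _≤_ (concat bs) × All (λ a → 0 < a) (concat bs)

-- x_λ ∈ I_{r,i}: for the monomial ideal I_{r,i}, a monomial lies in it
-- iff it is divisible by one of the monomial generators x₁^i or a block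
-- generator.
InIdeal : (r i : ℕ) → List ℕ → Set
InIdeal r i λ′ =
  (replicate i 1 ∣ₘ λ′) ⊎ (∃[ bs ] (IsBlockGenerator r i bs × (concat bs ∣ₘ λ′)))

-- λ_d (1-indexed), with λ_d := 0 for d ≤ 0 (and for d > s)
part : List ℕ → ℕ → ℕ
part λ′ zero = 0
part [] (suc d) = 0
part (x ∷ xs) (suc zero) = x
part (x ∷ xs) (suc (suc d)) = part xs (suc d)

-- pGo λ s i ℓ acc k : the values p_{i,ℓ}, …, p_{i,ℓ+k-1}, where acc is
-- Σ_{j<ℓ} p_{i,j}.  The index s - acc (ℓ ≤ i) resp. s + ℓ - i - acc
-- (ℓ > i) is truncated at 0, giving λ_0 = 0 for nonpositive indices.
pGo : List ℕ → (s i ℓ acc k : ℕ) → List ℕ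
pGo λ′ s i ℓ acc zero = []
pGo λ′ s i ℓ acc (suc k) =
  let v = part λ′ (if ℓ ≤ᵇ i then s ∸ acc else (s + ℓ) ∸ (i + acc))
  in v ∷ (if v ≡ᵇ 0 then replicate k 0 else pGo λ′ s i (suc ℓ) (acc + v) k)

pList : (r i : ℕ) → List ℕ → List ℕ
pList r i λ′ = pGo λ′ (length λ′) i 1 0 (r ∸ 1)

isNonzero : ℕ → Bool
isNonzero zero    = false
isNonzero (suc _) = true

isOne : ℕ → Bool
isOne n = n ≡ᵇ 1

Nri : (r i : ℕ) → List ℕ → ℕ
Nri r i λ′ = length (filterᵇ isNonzero (pList r i λ′))

InC : (r i : ℕ) → List ℕ → Set
InC r i λ′ =
  length (filterᵇ isOne λ′) < i ×
  ( (Nri r i λ′ < r ∸ 1)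
  ⊎ ((Nri r i λ′ ≡ r ∸ 1) × (length λ′ + (r ∸ i) ≤ sum (pList r i λ′))) )

-- greatest d with 0 ≤ d ≤ n and P d (d = 0 if none in 1..n)
greatest : (ℕ → Bool) → ℕ → ℕ
greatest P zero    = 0
greatest P (suc n) = if P (suc n) then suc n else greatest P n

sq : List ℕ → ℕ
sq μ = greatest (λ d → d ≤ᵇ part μ d) (length μ)

rect : List ℕ → ℕ
rect μ = greatest (λ h → suc h ≤ᵇ part μ h) (length μ)

muSeq : (r i : ℕ) → List ℕ → ℕ → List ℕ
muSeq r i λ′ zero    = λ′
muSeq r i λ′ (suc j) =
  let μ = muSeq r i λ′ j
  in drop (if suc j ≤ᵇ r ∸ i then rect μ else sq μ) μ

InD : (r i : ℕ) → List ℕ → Set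
InD r i λ′ = muSeq r i λ′ (r ∸ 1) ≡ []

{-# OPTIONS --safe #-}
-- The cut taking μ^(k) to μ^(k+1) has an offset e (1 for rect, 0 for sq) and a size c: it removes
-- c parts, all ≥ c + e, and leaves parts ≤ c + e. A block generator is compared with these cuts,
-- block r − k against the cut of μ^(k).
--
-- If μ^(r−1) is nonempty, its first part followed by the largest parts of μ^(r−2), …, μ^(0), in
-- increasing order, is a block generator dividing x_λ: the block after an entry p ≤ c + e has
-- p − e ≤ c entries. Conversely, if a generator with nonempty blocks divides x_λ, then its first
-- r − k blocks divide x_{μ^(k)} for every k: from k to k + 1, the last of these blocks, whose
-- entries are at least its size plus e, forces the cut to remove only parts it accounts for. So
-- its first block divides x_{μ^(r−1)}. A generator with an empty block is divisible by x₁^i, and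
-- only the i − 1 sq-cuts can remove a part 1, at most one each, so λ ∈ D_{r,i} has fewer than
-- i ones.
--
-- For C_{r,i}, the indices of the p_{i,ℓ} move from the smallest part of λ towards the largest,
-- each step as long as the next block of a generator. If a generator with nonempty blocks divides
-- x_λ, this walk does not run out within r − 1 steps, i.e. the second condition of C_{r,i} fails;
-- and if it does not run out, the parts it passes form a generator dividing x_λ.
module Submission where

open import Defs
open import Data.Nat
open import Data.Nat.Properties
open import Data.Bool using (Bool; true; false; if_then_else_; T)
open import Data.List using (List; []; _∷_; [_]; length; drop; take; replicate; concat; _++_; filterᵇ; reverse)
open import Data.List.Properties
  using (length-++; ++-assoc; take++drop≡id; length-take; length-drop; drop-drop; unfold-reverse;
         reverse-++; reverse-involutive; length-reverse; ++-identityʳ; length-filter; filter-all; filter-none; filter-++;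
         filter-accept; filter-reject)
open import Data.Nat.ListAction using (sum)
open import Data.List.Relation.Unary.All as All using (All; []; _∷_)
import Data.List.Relation.Unary.All.Properties as All
open import Data.List.Relation.Unary.AllPairs using (AllPairs; []; _∷_)
import Data.List.Relation.Unary.AllPairs.Properties as AllPairs
open import Data.List.Relation.Unary.Linked using (Linked)
open import Data.List.Relation.Unary.Linked.Properties using (Linked⇒AllPairs; AllPairs⇒Linked)
open import Data.List.Relation.Binary.Sublist.Propositional using (_⊆_; []; _∷_; _∷ʳ_; ⊆-refl; ⊆-trans; minimum)
open import Data.List.Relation.Binary.Sublist.Propositional.Properties
  using (All-resp-⊆; drop-⊆; drop⁺-≥; ++⁺)
open import Data.List.Relation.Binary.Permutation.Propositional using (_↭_; prep; swap; ↭-refl; ↭-sym; ↭-trans)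
open import Data.List.Relation.Binary.Permutation.Propositional.Properties
  using (All-resp-↭; filter-↭; ↭-length; ↭-reverse; shift; ++⁺ʳ)
open import Data.Product as Product using (_×_; _,_; proj₁; proj₂; ∃-syntax)
open import Data.Sum as Sum using (_⊎_; inj₁; inj₂)
open import Data.Unit using (tt)
open import Function.Base using (_∘_; const)
open import Function.Bundles using (_⇔_; mk⇔; Equivalence)
open import Relation.Nullary using (¬_; yes; no; contradiction)
open import Relation.Nullary.Decidable using (T?)
open import Relation.Nullary.Reflects using (ofʸ; ofⁿ)
open import Relation.Binary.PropositionalEquality using (_≡_; _≢_; refl; sym; trans; cong; cong₂; subst; subst₂; module ≡-Reasoning)

count : (ℕ → Bool) → List ℕ → ℕ
count p xs = length (filterᵇ p xs)

count-++ : ∀ p xs ys → count p (xs ++ ys) ≡ count p xs + count p ys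
count-++ p xs ys = trans (cong length (filter-++ (T? ∘ p) xs ys)) (length-++ (filterᵇ p xs))

count-↭ : ∀ p {xs ys} → xs ↭ ys → count p xs ≡ count p ys
count-↭ p xs↭ys = ↭-length (filter-↭ (T? ∘ p) xs↭ys)

count-≤-length : ∀ p xs → count p xs ≤ length xs
count-≤-length p = length-filter (T? ∘ p)

count-all : ∀ p {xs} → All (T ∘ p) xs → count p xs ≡ length xs
count-all p ps = cong length (filter-all (T? ∘ p) ps)

count-none : ∀ p {xs} → All (¬_ ∘ T ∘ p) xs → count p xs ≡ 0
count-none p ¬ps = cong length (filter-none (T? ∘ p) ¬ps)

count-accept : ∀ p x xs → T (p x) → count p (x ∷ xs) ≡ suc (count p xs)
count-accept p x xs px = cong length (filter-accept (T? ∘ p) px)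

count-reject : ∀ p x xs → ¬ T (p x) → count p (x ∷ xs) ≡ count p xs
count-reject p x xs ¬px = cong length (filter-reject (T? ∘ p) ¬px)

count-mono : ∀ {p q} xs → All (λ x → T (p x) → T (q x)) xs → count p xs ≤ count q xs
count-mono []       []              = z≤n
count-mono {p} {q} (x ∷ xs) (p⇒q ∷ ps⇒qs) with T? (p x) | T? (q x)
... | yes px | _      = subst₂ _≤_ (sym (count-accept p x xs px)) (sym (count-accept q x xs (p⇒q px))) (s≤s (count-mono xs ps⇒qs))
... | no ¬px | yes qx = subst₂ _≤_ (sym (count-reject p x xs ¬px)) (sym (count-accept q x xs qx)) (m≤n⇒m≤1+n (count-mono xs ps⇒qs))
... | no ¬px | no ¬qx = subst₂ _≤_ (sym (count-reject p x xs ¬px)) (sym (count-reject q x xs ¬qx)) (count-mono xs ps⇒qs)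

count-≡ᵇ-none : ∀ v {xs} → All (_≢ v) xs → count (_≡ᵇ v) xs ≡ 0
count-≡ᵇ-none v xs≢v = count-none (_≡ᵇ v) (All.map (λ {x} x≢v → x≢v ∘ ≡ᵇ⇒≡ x v) xs≢v)

count-true : ∀ xs → count (const true) xs ≡ length xs
count-true xs = count-all (const true) (All.universal (const tt) xs)

infix 4 _≼_

record _≼_ (xs ys : List ℕ) : Set where
  constructor mk≼
  field count-≤ : ∀ p → count p xs ≤ count p ys
open _≼_

≼-length : ∀ {xs ys} → xs ≼ ys → length xs ≤ length ys
≼-length {xs} {ys} xs≼ys = subst₂ _≤_ (count-true xs) (count-true ys) (count-≤ xs≼ys (const true))

≼-++⁻ˡ : ∀ xs {ys zs} → xs ++ ys ≼ zs → xs ≼ zs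
≼-++⁻ˡ xs {ys} h = mk≼ λ p → ≤-trans (≤-trans (m≤m+n _ _) (≤-reflexive (sym (count-++ p xs ys)))) (count-≤ h p)

∣ₘ⇒≼ : ∀ {xs ys} → xs ∣ₘ ys → xs ≼ ys
∣ₘ⇒≼ {xs} {ys} (ρ , xs++ρ↭ys) = mk≼ λ p → begin
  count p xs              ≤⟨ m≤m+n _ _ ⟩
  count p xs + count p ρ  ≡⟨ count-++ p xs ρ ⟨
  count p (xs ++ ρ)       ≡⟨ count-↭ p xs++ρ↭ys ⟩
  count p ys              ∎
  where open ≤-Reasoning

extract : ∀ x ys → 0 < count (_≡ᵇ x) ys → ∃[ zs ] ys ↭ x ∷ zs
extract x (y ∷ ys) h with T? (y ≡ᵇ x)
... | yes y≡ᵇx with refl ← ≡ᵇ⇒≡ y x y≡ᵇx = ys , ↭-refl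
... | no  y≢ᵇx with zs , ys↭ ← extract x ys (subst (0 <_) (count-reject (_≡ᵇ x) y ys y≢ᵇx) h) =
  y ∷ zs , ↭-trans (prep y ys↭) (swap y x ↭-refl)

count-∷-cancel : ∀ p x xs {ys zs} → count p (x ∷ xs) ≤ count p ys → ys ↭ x ∷ zs → count p xs ≤ count p zs
count-∷-cancel p x xs {ys} {zs} le ys↭x∷zs = +-cancelˡ-≤ (count p [ x ]) _ _ (begin
  count p [ x ] + count p xs  ≡⟨ count-++ p [ x ] xs ⟨
  count p (x ∷ xs)            ≤⟨ le ⟩
  count p ys                  ≡⟨ count-↭ p ys↭x∷zs ⟩
  count p (x ∷ zs)            ≡⟨ count-++ p [ x ] zs ⟩
  count p [ x ] + count p zs  ∎)
  where open ≤-Reasoning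

multiplicities⇒∣ₘ : ∀ xs ys → (∀ v → count (_≡ᵇ v) xs ≤ count (_≡ᵇ v) ys) → xs ∣ₘ ys
multiplicities⇒∣ₘ []       ys _ = ys , ↭-refl
multiplicities⇒∣ₘ (x ∷ xs) ys h
  with zs , ys↭x∷zs ← extract x ys (≤-trans (subst (0 <_) (sym (count-accept (_≡ᵇ x) x xs (≡⇒≡ᵇ x x refl))) z<s) (h x))
  with ρ , xs++ρ↭zs ← multiplicities⇒∣ₘ xs zs (λ v → count-∷-cancel (_≡ᵇ v) x xs (h v) ys↭x∷zs)
  = ρ , ↭-trans (prep x xs++ρ↭zs) (↭-sym ys↭x∷zs)

multiplicities⇒≼ : ∀ xs ys → (∀ v → count (_≡ᵇ v) xs ≤ count (_≡ᵇ v) ys) → xs ≼ ys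
multiplicities⇒≼ xs ys h = ∣ₘ⇒≼ (multiplicities⇒∣ₘ xs ys h)

⊆⇒∣ₘ : ∀ {xs ys} → xs ⊆ ys → xs ∣ₘ ys
⊆⇒∣ₘ [] = [] , ↭-refl
⊆⇒∣ₘ {xs} (y ∷ʳ xs⊆ys) with ρ , xs++ρ↭ys ← ⊆⇒∣ₘ xs⊆ys = y ∷ ρ , ↭-trans (shift y xs ρ) (prep y xs++ρ↭ys)
⊆⇒∣ₘ (refl ∷ xs⊆ys) with ρ , xs++ρ↭ys ← ⊆⇒∣ₘ xs⊆ys = ρ , prep _ xs++ρ↭ys

AllPairs-resp-⊆ : ∀ {R : ℕ → ℕ → Set} {xs ys} → xs ⊆ ys → AllPairs R ys → AllPairs R xs
AllPairs-resp-⊆ []           []         = []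
AllPairs-resp-⊆ (_ ∷ʳ xs⊆ys) (_ ∷ Rys)  = AllPairs-resp-⊆ xs⊆ys Rys
AllPairs-resp-⊆ (refl ∷ xs⊆ys) (Ry ∷ Rys) = All-resp-⊆ xs⊆ys Ry ∷ AllPairs-resp-⊆ xs⊆ys Rys

All-reverse : ∀ {P : ℕ → Set} {xs} → All P xs → All P (reverse xs)
All-reverse {xs = xs} = All-resp-↭ (↭-sym (↭-reverse xs))

partition-descending : ∀ {λ′} → IsPartition λ′ → AllPairs _≥_ λ′
partition-descending = Linked⇒AllPairs (λ b≤a c≤b → ≤-trans c≤b b≤a) ∘ proj₁

reverse-descending : ∀ {xs} → AllPairs _≥_ xs → AllPairs _≤_ (reverse xs)
reverse-descending {[]}     []            = []
reverse-descending {x ∷ xs} (x≥xs ∷ xs↓) rewrite unfold-reverse x xs =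
  AllPairs.++⁺ (reverse-descending xs↓) ([] ∷ []) (All.map (_∷ []) (All-reverse x≥xs))

ascending-last : ∀ x xs {ys} → AllPairs _≤_ (x ∷ xs ++ ys) →
                 All (_≤ last0 x xs) (x ∷ xs) × AllPairs _≤_ (last0 x xs ∷ ys)
ascending-last x []       x↑ = (≤-refl ∷ []) , x↑
ascending-last x (y ∷ xs) ((x≤y ∷ _) ∷ y↑) with ascending-last y xs y↑
... | y≤l ∷ xs≤l , l↑ = (≤-trans x≤y y≤l ∷ y≤l ∷ xs≤l) , l↑

All-last0 : ∀ {P : ℕ → Set} x xs → All P (x ∷ xs) → P (last0 x xs)
All-last0 x []       (px ∷ _)   = px
All-last0 x (y ∷ xs) (_ ∷ pxs) = All-last0 y xs pxs

-- The invariant of the block-by-block inductions: X holds the blocks already passed, ending with p.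
Separated : ℕ → List ℕ → List (List ℕ) → Set
Separated p X R = All (_≤ p) X × AllPairs _≤_ (p ∷ concat R)

separated-step : ∀ {p X b bs R} → Separated p X ((b ∷ bs) ∷ R) →
                 All (p ≤_) (b ∷ bs) × Separated (last0 b bs) (X ++ b ∷ bs) R
separated-step {p} {b = b} {bs} (X≤p , p≤ ∷ B↑) with ascending-last b bs B↑
... | B≤l , l↑ = p≤B , All.++⁺ (All.map (λ x≤p → ≤-trans x≤p (All-last0 b bs p≤B)) X≤p) B≤l , l↑
  where
  p≤B : All (p ≤_) (b ∷ bs)
  p≤B = All.++⁻ˡ (b ∷ bs) p≤

part-drop : ∀ μ c → part (drop c μ) 1 ≡ part μ (suc c)
part-drop []      zero    = refl
part-drop []      (suc c) = refl
part-drop (x ∷ μ) zero    = refl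
part-drop (x ∷ μ) (suc c) = part-drop μ c

part-beyond : ∀ μ {d} → length μ < d → part μ d ≡ 0
part-beyond []      {suc d}        _       = refl
part-beyond (x ∷ μ) {suc (suc d)} (s≤s h) = part-beyond μ h

part-positive : ∀ {μ d} → All (0 <_) μ → 1 ≤ d → d ≤ length μ → 0 < part μ d
part-positive {x ∷ μ} {suc zero}    (x>0 ∷ _)  _ _       = x>0
part-positive {x ∷ μ} {suc (suc d)} (_ ∷ μ>0) _ (s≤s h) = part-positive μ>0 z<s h

part-≤ : ∀ {x} μ d → All (_≤ x) μ → part μ d ≤ x
part-≤ μ       zero          _           = z≤n
part-≤ []      (suc d)       _           = z≤n
part-≤ (y ∷ μ) (suc zero)    (y≤x ∷ _)   = y≤x
part-≤ (y ∷ μ) (suc (suc d)) (_ ∷ μ≤x)  = part-≤ μ (suc d) μ≤x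

All-≤-head : ∀ {μ} → AllPairs _≥_ μ → All (_≤ part μ 1) μ
All-≤-head []           = []
All-≤-head (x≥μ ∷ _) = ≤-refl ∷ x≥μ

≤-part-take : ∀ μ c → AllPairs _≥_ μ → All (part μ c ≤_) (take c μ)
≤-part-take μ       zero          _           = []
≤-part-take []      (suc c)       _           = []
≤-part-take (x ∷ μ) (suc zero)    _           = ≤-refl ∷ []
≤-part-take (x ∷ μ) (suc (suc c)) (x≥μ ∷ μ↓) = part-≤ μ (suc c) x≥μ ∷ ≤-part-take μ (suc c) μ↓

part-≤-of-count : ∀ μ {q d} → AllPairs _≥_ μ → 1 ≤ d → length μ < d + count (_≤ᵇ q) μ → part μ d ≤ q
part-≤-of-count []      {d = suc d}     _           _ _ = z≤n
part-≤-of-count (x ∷ μ) {q} {suc d} (x≥μ ∷ μ↓) _ h with x ≤? q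
... | yes x≤q = ≤-trans (part-≤ (x ∷ μ) (suc d) (≤-refl ∷ x≥μ)) x≤q
... | no  x≰q with d | ≤-pred (subst (λ c → suc (length μ) < suc d + c) (count-reject (_≤ᵇ q) x μ (x≰q ∘ ≤ᵇ⇒≤ x q)) h)
...   | zero  | h′ = contradiction h′ (≤⇒≯ (count-≤-length _ μ))
...   | suc d | h′ = part-≤-of-count μ μ↓ z<s h′

≤-part-of-count : ∀ μ {v f} → AllPairs _≥_ μ → 1 ≤ f → f ≤ count (v ≤ᵇ_) μ → v ≤ part μ f
≤-part-of-count (x ∷ μ) {v} {suc f} (x≥μ ∷ μ↓) _ h with v ≤? x
... | no v≰x = contradiction (≤-trans h (≤-reflexive (count-none (v ≤ᵇ_) none))) λ ()
  where
    none : All (λ y → ¬ T (v ≤ᵇ y)) (x ∷ μ)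
    none = All.map (λ y≤x t → v≰x (≤-trans (≤ᵇ⇒≤ v _ t) y≤x)) (≤-refl ∷ x≥μ)
... | yes v≤x with f
...   | zero  = v≤x
...   | suc f = ≤-part-of-count μ μ↓ z<s (≤-pred (subst (suc (suc f) ≤_) (count-accept (v ≤ᵇ_) x μ (≤⇒≤ᵇ v≤x)) h))

part-positive⇒index : ∀ μ d → 0 < part μ d → 1 ≤ d × d ≤ length μ
part-positive⇒index μ zero    ()
part-positive⇒index μ (suc d) 0<part with suc d ≤? length μ
... | yes d<len = z<s , d<len
... | no  d≮len = contradiction (subst (0 <_) (part-beyond μ (≰⇒> d≮len)) 0<part) λ ()

part-⊆-drop : ∀ xs {d} → 1 ≤ d → d ≤ length xs → [ part xs d ] ⊆ drop (d ∸ 1) xs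
part-⊆-drop (x ∷ xs) {suc zero}    _ _       = refl ∷ minimum xs
part-⊆-drop (x ∷ xs) {suc (suc d)} _ (s≤s h) = part-⊆-drop xs z<s h

head-take-suc : ∀ n (xs : List ℕ) → part (take (suc n) xs) 1 ≡ part xs 1
head-take-suc n []       = refl
head-take-suc n (x ∷ xs) = refl

-- Durfee cuts

module _ (P : ℕ → Bool) where

  greatest-≤ : ∀ n → greatest P n ≤ n
  greatest-≤ zero = z≤n
  greatest-≤ (suc n) with P (suc n)
  ... | true  = ≤-refl
  ... | false = m≤n⇒m≤1+n (greatest-≤ n)

  greatest-maximal : ∀ n {m} → T (P m) → 1 ≤ m → m ≤ n → m ≤ greatest P n
  greatest-maximal zero    _  1≤m m≤0 = contradiction (≤-trans 1≤m m≤0) λ ()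
  greatest-maximal (suc n) {m} Pm 1≤m m≤1+n with P (suc n) in eq
  ... | true  = m≤1+n
  ... | false with m ≟ suc n
  ...   | yes refl = contradiction (subst T eq Pm) λ ()
  ...   | no  m≢1+n = greatest-maximal n Pm 1≤m (≤-pred (≤∧≢⇒< m≤1+n m≢1+n))

  greatest-satisfies : ∀ n → greatest P n ≡ 0 ⊎ T (P (greatest P n))
  greatest-satisfies zero = inj₁ refl
  greatest-satisfies (suc n) with P (suc n) in eq
  ... | true  = inj₂ (subst T (sym eq) tt)
  ... | false = greatest-satisfies n

  greatest-above : ∀ n {m} → greatest P n < m → m ≤ n → ¬ T (P m)
  greatest-above zero    g<m m≤0 = contradiction (≤-trans g<m m≤0) λ ()
  greatest-above (suc n) {m} g<m m≤1+n with P (suc n) in eq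
  ... | true  = contradiction (≤-trans g<m m≤1+n) (<-irrefl refl)
  ... | false with m ≟ suc n
  ...   | yes refl = subst T eq
  ...   | no  m≢1+n = greatest-above n g<m (≤-pred (≤∧≢⇒< m≤1+n m≢1+n))

-- durfee e μ is the side h of the largest h × (h + e) rectangle in the Young diagram of μ:
-- sq = durfee 0 and rect = durfee 1.
durfee : ℕ → List ℕ → ℕ
durfee e μ = greatest (λ h → e + h ≤ᵇ part μ h) (length μ)

peel : ℕ → List ℕ → List ℕ
peel e μ = drop (durfee e μ) μ

take-durfee-≥ : ∀ e {μ} → AllPairs _≥_ μ → All (e + durfee e μ ≤_) (take (durfee e μ) μ)
take-durfee-≥ e {μ} μ↓ with greatest-satisfies (λ h → e + h ≤ᵇ part μ h) (length μ)
... | inj₁ c≡0 rewrite c≡0 = []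
... | inj₂ Pc = All.map (≤-trans (≤ᵇ⇒≤ _ _ Pc)) (≤-part-take μ (durfee e μ) μ↓)

head-peel-≤ : ∀ e μ → part (peel e μ) 1 ≤ e + durfee e μ
head-peel-≤ e μ rewrite part-drop μ (durfee e μ) with suc (durfee e μ) ≤? length μ
... | no  c≮len rewrite part-beyond μ (≰⇒> c≮len) = z≤n
... | yes c<len = ≤-pred (subst (part μ (suc c) <_) (+-suc e c)
                    (≰⇒> (greatest-above _ (length μ) ≤-refl c<len ∘ ≤⇒≤ᵇ)))
  where
    c : ℕ
    c = durfee e μ

peel-≤ : ∀ e {μ} → AllPairs _≥_ μ → All (_≤ e + durfee e μ) (peel e μ)
peel-≤ e {μ} μ↓ = All.map (λ x≤head → ≤-trans x≤head (head-peel-≤ e μ)) (All-≤-head (AllPairs.drop⁺ (durfee e μ) μ↓))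

durfee-≥ : ∀ e {μ f} → AllPairs _≥_ μ → f ≤ count (e + f ≤ᵇ_) μ → f ≤ durfee e μ
durfee-≥ e {f = zero}     _  _ = z≤n
durfee-≥ e {μ} {suc f} μ↓ h =
  greatest-maximal _ (length μ) (≤⇒≤ᵇ (≤-part-of-count μ {e + suc f} μ↓ z<s h)) z<s (≤-trans h (count-≤-length _ μ))

offset : ℕ → ℕ → ℕ → ℕ
offset r i k = if suc k ≤ᵇ r ∸ i then 1 else 0

muSeq-suc : ∀ r i λ′ k → muSeq r i λ′ (suc k) ≡ peel (offset r i k) (muSeq r i λ′ k)
muSeq-suc r i λ′ k with suc k ≤ᵇ r ∸ i
... | true  = refl
... | false = refl

muSeq-descending : ∀ r i {λ′} k → AllPairs _≥_ λ′ → AllPairs _≥_ (muSeq r i λ′ k)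
muSeq-descending r i zero    λ↓ = λ↓
muSeq-descending r i {λ′} (suc k) λ↓ rewrite muSeq-suc r i λ′ k =
  AllPairs.drop⁺ (durfee (offset r i k) (muSeq r i λ′ k)) (muSeq-descending r i k λ↓)

ones-take-durfee : ∀ e {μ} → AllPairs _≥_ μ → count isOne (take (durfee e μ) μ) ≤ 1 ∸ e
ones-take-durfee e {μ} μ↓ with 2 ≤? e + durfee e μ
... | yes 2≤e+c = ≤-trans (≤-reflexive (count-≡ᵇ-none 1 (All.map (λ e+c≤x → λ { refl → 1+n≰n (≤-trans 2≤e+c e+c≤x) })
                                                             (take-durfee-≥ e μ↓)))) z≤n
... | no  2≰e+c = begin
  count isOne (take c μ)  ≤⟨ count-≤-length isOne (take c μ) ⟩
  length (take c μ)       ≡⟨ length-take c μ ⟩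
  c ⊓ length μ            ≤⟨ m⊓n≤m c _ ⟩
  c                       ≤⟨ m+n≤o⇒m≤o∸n c (subst (_≤ 1) (+-comm e c) (≤-pred (≰⇒> 2≰e+c))) ⟩
  1 ∸ e                   ∎
  where open ≤-Reasoning
        c : ℕ
        c = durfee e μ

ones-peel : ∀ e {μ} → AllPairs _≥_ μ → count isOne μ ≤ (1 ∸ e) + count isOne (peel e μ)
ones-peel e {μ} μ↓ = begin
  count isOne μ                                                ≡⟨ cong (count isOne) (take++drop≡id c μ) ⟨
  count isOne (take c μ ++ peel e μ)                           ≡⟨ count-++ isOne (take c μ) (peel e μ) ⟩
  count isOne (take c μ) + count isOne (peel e μ)              ≤⟨ +-monoˡ-≤ _ (ones-take-durfee e μ↓) ⟩
  (1 ∸ e) + count isOne (peel e μ)                             ∎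
  where open ≤-Reasoning
        c : ℕ
        c = durfee e μ

sq-cuts-suc : ∀ r i k → (1 ∸ offset r i k) + (k ∸ (r ∸ i)) ≡ suc k ∸ (r ∸ i)
sq-cuts-suc r i k with suc k ≤ᵇ r ∸ i | ≤ᵇ-reflects-≤ (suc k) (r ∸ i)
... | true  | ofʸ k<r∸i = trans (m≤n⇒m∸n≡0 (<⇒≤ k<r∸i)) (sym (m≤n⇒m∸n≡0 k<r∸i))
... | false | ofⁿ k≮r∸i = sym (+-∸-assoc 1 (≤-pred (≰⇒> k≮r∸i)))

-- k ∸ (r ∸ i) is the number of sq-cuts among the first k cuts.
ones-muSeq : ∀ r i {λ′} k → AllPairs _≥_ λ′ → count isOne λ′ ≤ (k ∸ (r ∸ i)) + count isOne (muSeq r i λ′ k)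
ones-muSeq r i {λ′} zero    λ↓ = m≤n+m _ _
ones-muSeq r i {λ′} (suc k) λ↓ = begin
  count isOne λ′                                        ≤⟨ ones-muSeq r i k λ↓ ⟩
  (k ∸ (r ∸ i)) + count isOne μ                         ≤⟨ +-monoʳ-≤ (k ∸ (r ∸ i)) (ones-peel e (muSeq-descending r i k λ↓)) ⟩
  (k ∸ (r ∸ i)) + ((1 ∸ e) + count isOne (peel e μ))    ≡⟨ +-assoc (k ∸ (r ∸ i)) _ _ ⟨
  ((k ∸ (r ∸ i)) + (1 ∸ e)) + count isOne (peel e μ)    ≡⟨ cong (_+ count isOne (peel e μ)) (trans (+-comm (k ∸ (r ∸ i)) _) (sq-cuts-suc r i k)) ⟩
  (suc k ∸ (r ∸ i)) + count isOne (peel e μ)            ≡⟨ cong (λ ν → (suc k ∸ (r ∸ i)) + count isOne ν) (muSeq-suc r i λ′ k) ⟨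
  (suc k ∸ (r ∸ i)) + count isOne (muSeq r i λ′ (suc k)) ∎
  where open ≤-Reasoning
        μ : List ℕ
        μ = muSeq r i λ′ k
        e : ℕ
        e = offset r i k

ones-bound : ∀ {r i λ′} → 1 ≤ i → i ≤ r → AllPairs _≥_ λ′ → InD r i λ′ → count isOne λ′ < i
ones-bound {suc r} {suc i} {λ′} _ (s≤s i≤r) λ↓ D = s≤s (begin
  count isOne λ′                                            ≤⟨ ones-muSeq (suc r) (suc i) r λ↓ ⟩
  (r ∸ (r ∸ i)) + count isOne (muSeq (suc r) (suc i) λ′ r)  ≡⟨ cong₂ _+_ (m∸[m∸n]≡n i≤r) (cong (count isOne) D) ⟩
  i + 0                                                     ≡⟨ +-identityʳ i ⟩
  i                                                         ∎)
  where open ≤-Reasoning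

deficit : ℕ → ℕ → ℕ
deficit i j with j ≤? i
... | yes _ = 0
... | no  _ = 1

fsize≡∸deficit : ∀ i j p → fsize i j p ≡ p ∸ deficit i j
fsize≡∸deficit i j p with j ≤? i
... | yes _ = refl
... | no  _ = refl

fsize-+-deficit : ∀ i j {p} → 1 ≤ p → fsize i j p + deficit i j ≡ p
fsize-+-deficit i j 1≤p with j ≤? i
... | yes _ = +-identityʳ _
... | no  _ = m∸n+n≡m 1≤p

∸-swap : ∀ {r i k} → suc k ≤ r ∸ i → suc i ≤ r ∸ k
∸-swap {r} {i} {k} k<r∸i = m+n≤o⇒m≤o∸n (suc i) (subst (_≤ r) (cong suc (+-comm k i)) (m≤o∸n⇒m+n≤o (suc k) i≤r k<r∸i))
  where
    i≤r : i ≤ r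
    i≤r = <⇒≤ (m∸n≢0⇒n<m λ r∸i≡0 → contradiction (subst (suc k ≤_) r∸i≡0 k<r∸i) λ ())

offset≡deficit : ∀ r i k → offset r i k ≡ deficit i (r ∸ k)
offset≡deficit r i k with suc k ≤ᵇ r ∸ i | ≤ᵇ-reflects-≤ (suc k) (r ∸ i) | r ∸ k ≤? i
... | true  | ofʸ k<r∸i | yes r∸k≤i = contradiction (∸-swap k<r∸i) (≤⇒≯ r∸k≤i)
... | true  | ofʸ _     | no  _     = refl
... | false | ofⁿ _     | yes _     = refl
... | false | ofⁿ k≮r∸i | no  r∸k≰i = contradiction (∸-swap (≰⇒> r∸k≰i)) k≮r∸i

fsize-0 : ∀ i j → fsize i j 0 ≡ 0
fsize-0 i j with j ≤? i
... | yes _ = refl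
... | no  _ = refl

fsize-mono : ∀ i j {v p} → v ≤ p → fsize i j v ≤ fsize i j p
fsize-mono i j v≤p with j ≤? i
... | yes _ = v≤p
... | no  _ = ∸-monoˡ-≤ 1 v≤p

∸-suc-+ : ∀ {f X} → suc f ≤ X → (X ∸ suc f) + f ≡ X ∸ 1
∸-suc-+ {f} {X} f<X = trans (cong (_+ f) (sym (∸-+-assoc X 1 f))) (m∸n+n≡m (m+n≤o⇒m≤o∸n f (subst (_≤ X) (+-comm 1 f) f<X)))

suc-∸-deficit : ∀ i ℓ → suc ℓ ∸ i ≡ (ℓ ∸ i) + deficit i (suc ℓ)
suc-∸-deficit i ℓ with suc ℓ ≤? i
... | yes ℓ<i = trans (m≤n⇒m∸n≡0 ℓ<i) (sym (trans (+-identityʳ _) (m≤n⇒m∸n≡0 (<⇒≤ ℓ<i))))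
... | no  ℓ≮i = trans (+-∸-assoc 1 (≤-pred (≰⇒> ℓ≮i))) (+-comm 1 _)

-- Generators read off the cuts

take-++-⊆ : ∀ n (xs : List ℕ) {ys} → ys ⊆ drop n xs → take n xs ++ ys ⊆ xs
take-++-⊆ n xs {ys} ys⊆ = subst (take n xs ++ ys ⊆_) (take++drop≡id n xs) (++⁺ (⊆-refl {x = take n xs}) ys⊆)

reverse-reverse-++ : ∀ (xs ys zs : List ℕ) → reverse (reverse xs ++ ys) ++ zs ≡ reverse ys ++ (xs ++ zs)
reverse-reverse-++ xs ys zs rewrite reverse-++ (reverse xs) ys | reverse-involutive xs = ++-assoc (reverse ys) xs zs

last0-snoc : ∀ p ys x → last0 p (ys ++ [ x ]) ≡ x
last0-snoc p []       x = refl
last0-snoc p (y ∷ ys) x = last0-snoc y ys x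

lastOr0-reverse : ∀ xs → lastOr0 (reverse xs) ≡ part xs 1
lastOr0-reverse []       = refl
lastOr0-reverse (x ∷ xs) rewrite unfold-reverse x xs = last0-snoc 0 (reverse xs) x

head-take-≤ : ∀ n xs → part (take n xs) 1 ≤ part xs 1
head-take-≤ zero    xs       = z≤n
head-take-≤ (suc n) []       = z≤n
head-take-≤ (suc n) (x ∷ xs) = ≤-refl

blocks-inIdeal : ∀ {r i λ′} n rest → IsPartition λ′ → length rest ≡ r ∸ 1 → ValidBlocks i 2 n rest →
                 reverse (concat ((n ∷ []) ∷ rest)) ⊆ λ′ → InIdeal r i λ′
blocks-inIdeal n rest ip@(_ , λ>0) len valid sub =
  inj₂ (bs , (n , rest , refl , len , valid , ascending , positive) , divides)
  where
  bs : List (List ℕ)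
  bs = (n ∷ []) ∷ rest
  ascending : Linked _≤_ (concat bs)
  ascending = AllPairs⇒Linked (subst (AllPairs _≤_) (reverse-involutive (concat bs))
    (reverse-descending (AllPairs-resp-⊆ sub (partition-descending ip))))
  positive : All (0 <_) (concat bs)
  positive = subst (All (0 <_)) (reverse-involutive (concat bs)) (All-reverse (All-resp-⊆ sub λ>0))
  divides : concat bs ∣ₘ _
  divides with ρ , rev++ρ↭λ ← ⊆⇒∣ₘ sub = ρ , ↭-trans (++⁺ʳ ρ (↭-sym (↭-reverse (concat bs)))) rev++ρ↭λ

module CutBlocks (r i : ℕ) (λ′ : List ℕ) where

  μ : ℕ → List ℕ
  μ = muSeq r i λ′

  cutBlock : ℕ → ℕ → List ℕ
  cutBlock k p = reverse (take (fsize i (r ∸ k) p) (μ k))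

  cutBlocks : ℕ → ℕ → List (List ℕ)
  cutBlocks p zero    = []
  cutBlocks p (suc k) = cutBlock k p ∷ cutBlocks (lastOr0 (cutBlock k p)) k

  cutBlocks-length : ∀ p k → length (cutBlocks p k) ≡ k
  cutBlocks-length p zero    = refl
  cutBlocks-length p (suc k) = cong suc (cutBlocks-length _ k)

  fsize-≤-durfee : ∀ k {p} → p ≤ part (μ (suc k)) 1 → fsize i (r ∸ k) p ≤ durfee (offset r i k) (μ k)
  fsize-≤-durfee k {p} p≤head = begin
    fsize i (r ∸ k) p      ≡⟨ fsize≡∸deficit i (r ∸ k) p ⟩
    p ∸ deficit i (r ∸ k)  ≡⟨ cong (p ∸_) (offset≡deficit r i k) ⟨
    p ∸ e                  ≤⟨ m≤n+o⇒m∸n≤o p e (≤-trans p≤head head≤) ⟩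
    durfee e (μ k)         ∎
    where
    open ≤-Reasoning
    e : ℕ
    e = offset r i k
    head≤ : part (μ (suc k)) 1 ≤ e + durfee e (μ k)
    head≤ = subst (λ ν → part ν 1 ≤ e + durfee e (μ k)) (sym (muSeq-suc r i λ′ k)) (head-peel-≤ e (μ k))

  lastOr0-cutBlock : ∀ k p → lastOr0 (cutBlock k p) ≤ part (μ k) 1
  lastOr0-cutBlock k p = subst (_≤ part (μ k) 1) (sym (lastOr0-reverse (take f (μ k)))) (head-take-≤ f (μ k))
    where
    f : ℕ
    f = fsize i (r ∸ k) p

  cutBlocks-valid : ∀ j k {p} → j + k ≡ suc r → p ≤ part (μ k) 1 → ValidBlocks i j p (cutBlocks p k)
  cutBlocks-valid j zero    _   _      = tt
  cutBlocks-valid j (suc k) {p} j+k≡ p≤head = length-block , cutBlocks-valid (suc j) k (trans (sym (+-suc j k)) j+k≡) (lastOr0-cutBlock k p)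
    where
    r∸k≡j : r ∸ k ≡ j
    r∸k≡j = trans (cong (_∸ k) (sym (suc-injective (trans (sym (+-suc j k)) j+k≡)))) (m+n∸n≡m j k)
    length-block : length (cutBlock k p) ≡ fsize i j p
    length-block = begin
      length (cutBlock k p)                  ≡⟨ length-reverse (take (fsize i (r ∸ k) p) (μ k)) ⟩
      length (take (fsize i (r ∸ k) p) (μ k)) ≡⟨ length-take _ (μ k) ⟩
      fsize i (r ∸ k) p ⊓ length (μ k)       ≡⟨ m≤n⇒m⊓n≡m (≤-trans (fsize-≤-durfee k p≤head) (greatest-≤ _ (length (μ k)))) ⟩
      fsize i (r ∸ k) p                      ≡⟨ cong (λ j′ → fsize i j′ p) r∸k≡j ⟩
      fsize i j p                            ∎
      where open ≡-Reasoning

  cutBlocks-⊆ : ∀ k {p ys} → p ≤ part (μ k) 1 → ys ⊆ μ k → reverse (concat (cutBlocks p k)) ++ ys ⊆ λ′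
  cutBlocks-⊆ zero    _      ys⊆ = ys⊆
  cutBlocks-⊆ (suc k) {p} {ys} p≤head ys⊆ =
    subst (_⊆ λ′) (sym (reverse-reverse-++ (take f (μ k)) rest ys)) (cutBlocks-⊆ k (lastOr0-cutBlock k p) (take-++-⊆ f (μ k) ys⊆drop))
    where
    f : ℕ
    f = fsize i (r ∸ k) p
    rest : List ℕ
    rest = concat (cutBlocks (lastOr0 (cutBlock k p)) k)
    ys⊆drop : ys ⊆ drop f (μ k)
    ys⊆drop = ⊆-trans (subst (ys ⊆_) (muSeq-suc r i λ′ k) ys⊆) (drop⁺-≥ {xs = μ k} (fsize-≤-durfee k p≤head))

nonempty-muSeq⇒inIdeal : ∀ {r i λ′ x xs} → 1 ≤ r → IsPartition λ′ → muSeq r i λ′ (r ∸ 1) ≡ x ∷ xs → InIdeal r i λ′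
nonempty-muSeq⇒inIdeal {r} {i} {λ′} {x} {xs} 1≤r ip μ≡x∷xs =
  blocks-inIdeal {r} {i} x rest ip (cutBlocks-length x (r ∸ 1)) (cutBlocks-valid 2 (r ∸ 1) (cong suc (m+[n∸m]≡n 1≤r)) x≤head)
    (subst (_⊆ λ′) (sym (unfold-reverse x (concat rest))) (cutBlocks-⊆ (r ∸ 1) x≤head x⊆))
  where
  open CutBlocks r i λ′
  rest : List (List ℕ)
  rest = cutBlocks x (r ∸ 1)
  x≤head : x ≤ part (μ (r ∸ 1)) 1
  x≤head rewrite μ≡x∷xs = ≤-refl
  x⊆ : [ x ] ⊆ μ (r ∸ 1)
  x⊆ rewrite μ≡x∷xs = refl ∷ minimum xs

-- Generators dividing x_λ and the cuts

-- The parts of B, all ≥ w = |B| + e, force |B| ≤ c = durfee e μ, so the cut removes no value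
-- below w; and if w = e + c, then |B| = c and the removed parts of value w are accounted for by B.
module _ (e : ℕ) {μ X B : List ℕ} {w : ℕ} (μ↓ : AllPairs _≥_ μ) (XB≼μ : X ++ B ≼ μ)
         (|B|+e≡w : length B + e ≡ w) (w≤B : All (w ≤_) B) (X≤w : All (_≤ w) X) where

  private
    c : ℕ
    c = durfee e μ
    f : ℕ
    f = length B

    count-B : count (w ≤ᵇ_) B ≡ f
    count-B = count-all (w ≤ᵇ_) (All.map ≤⇒≤ᵇ w≤B)

    count-X++B : ∀ p → count p X + count p B ≤ count p μ
    count-X++B p = subst (_≤ count p μ) (count-++ p X B) (count-≤ XB≼μ p)

    count-μ : ∀ p → count p μ ≡ count p (take c μ) + count p (peel e μ)
    count-μ p = trans (cong (count p) (sym (take++drop≡id c μ))) (count-++ p (take c μ) (peel e μ))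

    f≤c : f ≤ c
    f≤c = durfee-≥ e μ↓ (begin
      f                         ≡⟨ count-B ⟨
      count (w ≤ᵇ_) B           ≤⟨ m≤n+m _ (count (w ≤ᵇ_) X) ⟩
      count (w ≤ᵇ_) X + count (w ≤ᵇ_) B ≤⟨ count-X++B (w ≤ᵇ_) ⟩
      count (w ≤ᵇ_) μ           ≡⟨ cong (λ w′ → count (w′ ≤ᵇ_) μ) (trans (sym |B|+e≡w) (+-comm f e)) ⟩
      count (e + f ≤ᵇ_) μ       ∎)
      where open ≤-Reasoning

    w≤e+c : w ≤ e + c
    w≤e+c = subst (_≤ e + c) (trans (+-comm e f) |B|+e≡w) (+-monoʳ-≤ e f≤c)

    count-below : ∀ v → v < e + c → count (_≡ᵇ v) X ≤ count (_≡ᵇ v) (peel e μ)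
    count-below v v<e+c = begin
      count (_≡ᵇ v) X                                        ≤⟨ m≤m+n _ _ ⟩
      count (_≡ᵇ v) X + count (_≡ᵇ v) B                     ≤⟨ count-X++B (_≡ᵇ v) ⟩
      count (_≡ᵇ v) μ                                        ≡⟨ count-μ (_≡ᵇ v) ⟩
      count (_≡ᵇ v) (take c μ) + count (_≡ᵇ v) (peel e μ)  ≡⟨ cong (_+ count (_≡ᵇ v) (peel e μ)) none-taken ⟩
      count (_≡ᵇ v) (peel e μ)                               ∎
      where
      open ≤-Reasoning
      none-taken : count (_≡ᵇ v) (take c μ) ≡ 0
      none-taken = count-≡ᵇ-none v (All.map (λ e+c≤x → λ { refl → <⇒≱ v<e+c e+c≤x }) (take-durfee-≥ e μ↓))

    count-above : ∀ v → w < v → count (_≡ᵇ v) X ≤ count (_≡ᵇ v) (peel e μ)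
    count-above v w<v = subst (_≤ count (_≡ᵇ v) (peel e μ)) (sym none-in-X) z≤n
      where
      none-in-X : count (_≡ᵇ v) X ≡ 0
      none-in-X = count-≡ᵇ-none v (All.map (λ x≤w → λ { refl → <⇒≱ w<v x≤w }) X≤w)

    count-at : w ≡ e + c → count (_≡ᵇ w) X ≤ count (_≡ᵇ w) (peel e μ)
    count-at w≡e+c = +-cancelʳ-≤ f _ _ (begin
      count (_≡ᵇ w) X + f                                    ≤⟨ +-monoˡ-≤ f (count-mono X (All.universal (λ _ → ≡ᵇ⇒≤ᵇ) X)) ⟩
      count (w ≤ᵇ_) X + f                                    ≡⟨ cong (count (w ≤ᵇ_) X +_) count-B ⟨
      count (w ≤ᵇ_) X + count (w ≤ᵇ_) B                     ≤⟨ count-X++B (w ≤ᵇ_) ⟩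
      count (w ≤ᵇ_) μ                                        ≡⟨ count-μ (w ≤ᵇ_) ⟩
      count (w ≤ᵇ_) (take c μ) + count (w ≤ᵇ_) (peel e μ)  ≤⟨ +-mono-≤ take-bound peel-bound ⟩
      f + count (_≡ᵇ w) (peel e μ)                           ≡⟨ +-comm f _ ⟩
      count (_≡ᵇ w) (peel e μ) + f                           ∎)
      where
      open ≤-Reasoning
      ≡ᵇ⇒≤ᵇ : ∀ {x} → T (x ≡ᵇ w) → T (w ≤ᵇ x)
      ≡ᵇ⇒≤ᵇ {x} x≡ᵇw = ≤⇒≤ᵇ (≤-reflexive (sym (≡ᵇ⇒≡ x w x≡ᵇw)))
      ≤ᵇ⇒≡ᵇ : ∀ {x} → x ≤ e + c → T (w ≤ᵇ x) → T (x ≡ᵇ w)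
      ≤ᵇ⇒≡ᵇ {x} x≤e+c w≤ᵇx = ≡⇒≡ᵇ x w (≤-antisym (subst (x ≤_) (sym w≡e+c) x≤e+c) (≤ᵇ⇒≤ w x w≤ᵇx))
      take-bound : count (w ≤ᵇ_) (take c μ) ≤ f
      take-bound = begin
        count (w ≤ᵇ_) (take c μ)  ≤⟨ count-≤-length _ (take c μ) ⟩
        length (take c μ)         ≡⟨ length-take c μ ⟩
        c ⊓ length μ              ≤⟨ m⊓n≤m c _ ⟩
        c                         ≡⟨ +-cancelˡ-≡ e c f (trans (sym w≡e+c) (trans (sym |B|+e≡w) (+-comm f e))) ⟩
        f                         ∎
      peel-bound : count (w ≤ᵇ_) (peel e μ) ≤ count (_≡ᵇ w) (peel e μ)
      peel-bound = count-mono (peel e μ) (All.map ≤ᵇ⇒≡ᵇ (peel-≤ e μ↓))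

    bound : ∀ v → count (_≡ᵇ v) X ≤ count (_≡ᵇ v) (peel e μ)
    bound v with v <? e + c | v ≤? w
    ... | yes v<e+c | _       = count-below v v<e+c
    ... | no  v≮e+c | no  v≰w = count-above v (≰⇒> v≰w)
    ... | no  v≮e+c | yes v≤w with refl ← ≤-antisym v≤w (≤-trans w≤e+c (≮⇒≥ v≮e+c)) =
      count-at (≤-antisym w≤e+c (≤-trans (≮⇒≥ v≮e+c) v≤w))

  peel-≼ : X ≼ peel e μ
  peel-≼ = multiplicities⇒≼ X (peel e μ) bound

module _ (r i : ℕ) {λ′ : List ℕ} (λ↓ : AllPairs _≥_ λ′) where

  strip-blocks : ∀ R {X j p} → ValidBlocks i j p R → All (λ b → 0 < length b) R → Separated p X R → 1 ≤ p →
                 j + length R ≡ suc r → X ++ concat R ≼ λ′ → X ≼ muSeq r i λ′ (length R)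
  strip-blocks [] {X} _ _ _ _ _ X≼λ = subst (_≼ λ′) (++-identityʳ X) X≼λ
  strip-blocks ((b ∷ bs) ∷ R) {X} {j} {p} (size , valid) (_ ∷ nonempty) sep 1≤p j+≡ XR≼λ
    with separated-step {R = R} sep
  ... | p≤B , sep′ = subst (X ≼_) (sym (muSeq-suc r i λ′ (length R)))
                       (peel-≼ e (muSeq-descending r i (length R) λ↓) XB≼μ |B|+e≡p p≤B (proj₁ sep))
    where
    e : ℕ
    e = offset r i (length R)
    r∸|R|≡j : r ∸ length R ≡ j
    r∸|R|≡j = trans (cong (_∸ length R) (sym (suc-injective (trans (sym (+-suc j (length R))) j+≡)))) (m+n∸n≡m j (length R))
    |B|+e≡p : length (b ∷ bs) + e ≡ p
    |B|+e≡p = trans (cong₂ _+_ size (trans (offset≡deficit r i (length R)) (cong (deficit i) r∸|R|≡j)))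
                    (fsize-+-deficit i j 1≤p)
    XB≼μ : X ++ b ∷ bs ≼ muSeq r i λ′ (length R)
    XB≼μ = strip-blocks R valid nonempty sep′ (≤-trans 1≤p (All-last0 b bs p≤B)) (trans (sym (+-suc j (length R))) j+≡)
             (subst (_≼ λ′) (sym (++-assoc X (b ∷ bs) (concat R))) XR≼λ)

InD⇒¬divisor : ∀ {r i λ′ bs} → 1 ≤ r → AllPairs _≥_ λ′ → InD r i λ′ → IsBlockGenerator r i bs →
               All (λ b → 0 < length b) bs → ¬ concat bs ≼ λ′
InD⇒¬divisor {r} {i} {λ′} 1≤r λ↓ D (n , rest , refl , len , valid , n↑ , n>0 ∷ _) (_ ∷ nonempty) bs≼λ =
  contradiction (count-≤ n≼[] (const true)) λ ()
  where
  n≼μ : [ n ] ≼ muSeq r i λ′ (length rest)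
  n≼μ = strip-blocks r i λ↓ rest valid nonempty ((≤-refl ∷ []) , Linked⇒AllPairs ≤-trans n↑) n>0
          (trans (cong (2 +_) len) (cong suc (m+[n∸m]≡n 1≤r))) bs≼λ
  n≼[] : [ n ] ≼ []
  n≼[] = subst ([ n ] ≼_) (trans (cong (muSeq r i λ′) len) D) n≼μ

-- Generators with an empty block

block-of-1 : ∀ i j bs → length (1 ∷ bs) ≡ fsize i j 1 → bs ≡ []
block-of-1 i j bs size with j ≤? i
block-of-1 i j [] _  | yes _ = refl
block-of-1 i j [] () | no  _

emptyBlock⇒ones : ∀ {i} j p R → ValidBlocks i j p R → 1 ≤ p → AllPairs _≤_ (p ∷ concat R) →
                  ¬ All (λ b → 0 < length b) R → p ≡ 1 × i < j + count isOne (concat R)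
emptyBlock⇒ones j p [] _ _ _ notAll = contradiction [] notAll
emptyBlock⇒ones {i} j p ([] ∷ R) (size , _) 1≤p _ _ with j ≤? i
... | yes _   = contradiction (subst (1 ≤_) (sym size) 1≤p) λ ()
... | no  j≰i = ≤-antisym (m∸n≡0⇒m≤n (sym size)) 1≤p , ≤-trans (≰⇒> j≰i) (m≤m+n j _)
emptyBlock⇒ones {i} j p ((b ∷ bs) ∷ R) (size , valid) 1≤p (p≤B++ ∷ B↑) notAll
  with ascending-last b bs B↑
... | b≤l ∷ _ , l↑
  with emptyBlock⇒ones (suc j) (last0 b bs) R valid (≤-trans 1≤p (≤-trans (All.head p≤B++) b≤l)) l↑ (notAll ∘ (z<s ∷_))
... | l≡1 , i<ones
  with refl ← ≤-antisym (≤-trans (All.head p≤B++) (subst (b ≤_) l≡1 b≤l)) 1≤p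
  with refl ← ≤-antisym (subst (b ≤_) l≡1 b≤l) (≤-trans 1≤p (All.head p≤B++))
  with refl ← block-of-1 i j bs size
  = refl , subst (i <_) (sym (+-suc j _)) i<ones

emptyBlock⇒manyOnes : ∀ {r i bs} → IsBlockGenerator r i bs → ¬ All (λ b → 0 < length b) bs →
                      i ≤ count isOne (concat bs)
emptyBlock⇒manyOnes (n , rest , refl , _ , valid , n↑ , n>0 ∷ _) notAll
  with refl , i<2+ones ← emptyBlock⇒ones 2 n rest valid n>0 (Linked⇒AllPairs ≤-trans n↑) (notAll ∘ (z<s ∷_))
  = ≤-pred i<2+ones

-- The sequence p_{i,ℓ}

module PSequence (λ′ : List ℕ) (i : ℕ) where

  s : ℕ
  s = length λ′

  index : ℕ → ℕ → ℕ
  index ℓ acc = if ℓ ≤ᵇ i then s ∸ acc else (s + ℓ) ∸ (i + acc)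

  pv : ℕ → ℕ → ℕ
  pv ℓ acc = part λ′ (index ℓ acc)

  pseq : ℕ → ℕ → ℕ → List ℕ
  pseq = pGo λ′ s i

  index-closed : ∀ ℓ acc → index ℓ acc ≡ (s + (ℓ ∸ i)) ∸ acc
  index-closed ℓ acc with ℓ ≤ᵇ i | ≤ᵇ-reflects-≤ ℓ i
  ... | true  | ofʸ ℓ≤i rewrite m≤n⇒m∸n≡0 ℓ≤i | +-identityʳ s = refl
  ... | false | ofⁿ ℓ≰i = trans (sym (∸-+-assoc (s + ℓ) i acc)) (cong (_∸ acc) (+-∸-assoc s (<⇒≤ (≰⇒> ℓ≰i))))

  index-suc : ∀ ℓ acc {v} → 1 ≤ v → index (suc ℓ) (acc + v) ≡ index ℓ acc ∸ fsize i (suc ℓ) v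
  index-suc ℓ acc {v} 1≤v = begin
    index (suc ℓ) (acc + v)                        ≡⟨ index-closed (suc ℓ) (acc + v) ⟩
    (s + (suc ℓ ∸ i)) ∸ (acc + v)                  ≡⟨ cong₂ (λ a b → (s + a) ∸ (acc + b)) (suc-∸-deficit i ℓ) (sym (fsize-+-deficit i (suc ℓ) 1≤v)) ⟩
    (s + ((ℓ ∸ i) + d)) ∸ (acc + (f + d))          ≡⟨ cong₂ _∸_ (sym (+-assoc s _ d)) (sym (+-assoc acc f d)) ⟩
    ((s + (ℓ ∸ i)) + d) ∸ ((acc + f) + d)          ≡⟨ cong₂ _∸_ (+-comm _ d) (+-comm _ d) ⟩
    (d + (s + (ℓ ∸ i))) ∸ (d + (acc + f))          ≡⟨ [m+n]∸[m+o]≡n∸o d _ _ ⟩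
    (s + (ℓ ∸ i)) ∸ (acc + f)                      ≡⟨ ∸-+-assoc _ acc f ⟨
    ((s + (ℓ ∸ i)) ∸ acc) ∸ f                      ≡⟨ cong (_∸ f) (index-closed ℓ acc) ⟨
    index ℓ acc ∸ f                                ∎
    where open ≡-Reasoning
          d : ℕ
          d = deficit i (suc ℓ)
          f : ℕ
          f = fsize i (suc ℓ) v

  -- Good ℓ acc k: p_ℓ, …, p_{ℓ+k−1} are nonzero and the index of p_{ℓ+k} is still positive.
  Good : ℕ → ℕ → ℕ → Set
  Good ℓ acc zero    = 1 ≤ index ℓ acc
  Good ℓ acc (suc k) = 1 ≤ pv ℓ acc × Good (suc ℓ) (acc + pv ℓ acc) k

  Exhausted : ℕ → ℕ → ℕ → Set
  Exhausted ℓ acc k = count isNonzero (pseq ℓ acc k) < k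
                    ⊎ count isNonzero (pseq ℓ acc k) ≡ k × index (ℓ + k) (acc + sum (pseq ℓ acc k)) ≡ 0

  good⇒¬exhausted : ∀ ℓ acc k → Good ℓ acc k → ¬ Exhausted ℓ acc k
  good⇒¬exhausted ℓ acc zero g (inj₂ (_ , idx≡0)) rewrite +-identityʳ ℓ | +-identityʳ acc =
    contradiction (subst (1 ≤_) idx≡0 g) λ ()
  good⇒¬exhausted ℓ acc (suc k) (1≤v , g) with pv ℓ acc | 1≤v
  ... | suc w | _ = λ where
    (inj₁ (s≤s lt)) → good⇒¬exhausted (suc ℓ) (acc + suc w) k g (inj₁ lt)
    (inj₂ (eq , idx≡0)) → good⇒¬exhausted (suc ℓ) (acc + suc w) k g
      (inj₂ (suc-injective eq , subst₂ (λ a b → index a b ≡ 0) (+-suc ℓ k) (sym (+-assoc acc (suc w) _)) idx≡0))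

  good⊎exhausted : ∀ ℓ acc k → Good ℓ acc k ⊎ Exhausted ℓ acc k
  good⊎exhausted ℓ acc zero with index ℓ acc in idx≡
  ... | zero  = inj₂ (inj₂ (refl , subst₂ (λ a b → index a b ≡ 0) (sym (+-identityʳ ℓ)) (sym (+-identityʳ acc)) idx≡))
  ... | suc _ = inj₁ z<s
  good⊎exhausted ℓ acc (suc k) with pv ℓ acc
  ... | zero  = inj₂ (inj₁ (s≤s (subst (_≤ k) (sym (count-none isNonzero (All.replicate⁺ k λ ()))) z≤n)))
  ... | suc w with good⊎exhausted (suc ℓ) (acc + suc w) k
  ...   | inj₁ g                 = inj₁ (z<s , g)
  ...   | inj₂ (inj₁ lt)         = inj₂ (inj₁ (s≤s lt))
  ...   | inj₂ (inj₂ (eq , idx≡0)) =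
    inj₂ (inj₂ (cong suc eq , subst₂ (λ a b → index a b ≡ 0) (sym (+-suc ℓ k)) (+-assoc acc (suc w) _) idx≡0))

  final-index : ∀ {r} Σ′ → 1 ≤ r → index (1 + (r ∸ 1)) (0 + Σ′) ≡ (s + (r ∸ i)) ∸ Σ′
  final-index {r} Σ′ 1≤r = trans (cong (λ ℓ → index ℓ Σ′) (m+[n∸m]≡n 1≤r)) (index-closed r Σ′)

  exhausted⇔C₂ : ∀ {r} → 1 ≤ r →
    Exhausted 1 0 (r ∸ 1) ⇔ (Nri r i λ′ < r ∸ 1 ⊎ Nri r i λ′ ≡ r ∸ 1 × s + (r ∸ i) ≤ sum (pList r i λ′))
  exhausted⇔C₂ 1≤r = mk⇔
    (Sum.map₂ (Product.map₂ λ idx≡0 → m∸n≡0⇒m≤n (trans (sym (final-index _ 1≤r)) idx≡0)))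
    (Sum.map₂ (Product.map₂ λ s+≤Σ → trans (final-index _ 1≤r) (m≤n⇒m∸n≡0 s+≤Σ)))

  good-index : ∀ ℓ acc k → Good ℓ acc k → 1 ≤ index ℓ acc
  good-index ℓ acc zero    1≤idx     = 1≤idx
  good-index ℓ acc (suc k) (1≤v , _) = proj₁ (part-positive⇒index λ′ (index ℓ acc) 1≤v)

  index-1-0 : 1 ≤ i → index 1 0 ≡ s
  index-1-0 1≤i = trans (index-closed 1 0) (trans (cong (s +_) (m≤n⇒m∸n≡0 1≤i)) (+-identityʳ s))

  positive-index : ∀ x idx → x ≤ s → s < idx + x → 1 ≤ idx
  positive-index x idx x≤s s<idx+x = +-cancelʳ-≤ x 1 idx (≤-trans (s≤s x≤s) s<idx+x)

  module _ (λ↓ : AllPairs _≥_ λ′) (λ>0 : All (0 <_) λ′) where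

    blocks⇒good : ∀ R {X ℓ acc p} → ValidBlocks i (suc ℓ) p R → All (λ b → 0 < length b) R → Separated p X R →
                  X ++ concat R ≼ λ′ → index ℓ acc ≤ s → s < index ℓ acc + length X → Good ℓ acc (length R)
    blocks⇒good [] {X} {ℓ} {acc} _ _ _ X≼λ _ s<idx+X =
      positive-index (length X) (index ℓ acc) (≼-length (subst (_≼ λ′) (++-identityʳ X) X≼λ)) s<idx+X
    blocks⇒good ((b ∷ bs) ∷ R) {X} {ℓ} {acc} {p} (size , valid) (_ ∷ nonempty) sep XR≼λ idx≤s s<idx+X
      with separated-step {R = R} sep
    ... | _ , sep′ = 1≤v , blocks⇒good R valid nonempty sep′ XB≼λ idx′≤s s<idx′+XB
      where
      idx : ℕ
      idx = index ℓ acc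
      v : ℕ
      v = pv ℓ acc
      fv : ℕ
      fv = fsize i (suc ℓ) v
      X≼λ : X ≼ λ′
      X≼λ = ≼-++⁻ˡ X XR≼λ
      1≤idx : 1 ≤ idx
      1≤idx = positive-index (length X) idx (≼-length X≼λ) s<idx+X
      1≤v : 1 ≤ v
      1≤v = part-positive λ>0 1≤idx idx≤s
      X≤count : length X ≤ count (_≤ᵇ p) λ′
      X≤count = ≤-trans (≤-reflexive (sym (count-all (_≤ᵇ p) (All.map ≤⇒≤ᵇ (proj₁ sep))))) (count-≤ X≼λ (_≤ᵇ p))
      v≤p : v ≤ p
      v≤p = part-≤-of-count λ′ λ↓ 1≤idx (≤-trans s<idx+X (+-monoʳ-≤ idx X≤count))
      XB≼λ : (X ++ b ∷ bs) ++ concat R ≼ λ′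
      XB≼λ = subst (_≼ λ′) (sym (++-assoc X (b ∷ bs) (concat R))) XR≼λ
      idx′≤s : index (suc ℓ) (acc + v) ≤ s
      idx′≤s = subst (_≤ s) (sym (index-suc ℓ acc 1≤v)) (≤-trans (m∸n≤m idx fv) idx≤s)
      s<idx′+XB : s < index (suc ℓ) (acc + v) + length (X ++ b ∷ bs)
      s<idx′+XB = begin-strict
        s                                          <⟨ s<idx+X ⟩
        idx + length X                             ≤⟨ +-monoˡ-≤ (length X) (m≤n+m∸n idx fv) ⟩
        (fv + (idx ∸ fv)) + length X               ≡⟨ cong (_+ length X) (+-comm fv _) ⟩
        ((idx ∸ fv) + fv) + length X               ≡⟨ +-assoc (idx ∸ fv) fv (length X) ⟩
        (idx ∸ fv) + (fv + length X)               ≡⟨ cong ((idx ∸ fv) +_) (+-comm fv (length X)) ⟩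
        (idx ∸ fv) + (length X + fv)               ≤⟨ +-monoʳ-≤ (idx ∸ fv) (+-monoʳ-≤ (length X) (fsize-mono i (suc ℓ) v≤p)) ⟩
        (idx ∸ fv) + (length X + fsize i (suc ℓ) p) ≡⟨ cong₂ _+_ (index-suc ℓ acc 1≤v) (trans (length-++ X) (cong (length X +_) size)) ⟨
        index (suc ℓ) (acc + v) + length (X ++ b ∷ bs) ∎
        where open ≤-Reasoning

    divisor⇒good : ∀ {r bs} → 1 ≤ i → IsBlockGenerator r i bs → All (λ b → 0 < length b) bs → concat bs ≼ λ′ →
                   Good 1 0 (r ∸ 1)
    divisor⇒good 1≤i (n , rest , refl , len , valid , n↑ , _) (_ ∷ nonempty) bs≼λ =
      subst (Good 1 0) len (blocks⇒good rest valid nonempty ((≤-refl ∷ []) , Linked⇒AllPairs ≤-trans n↑) bs≼λ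
        (≤-reflexive (index-1-0 1≤i)) (subst (λ t → s < t + 1) (sym (index-1-0 1≤i)) (m<m+n s z<s)))

  -- The parts λ_{X−f}, …, λ_{X−1} in increasing order (λ is indexed from 1).
  segment : ℕ → ℕ → List ℕ
  segment f X = reverse (take f (drop (X ∸ suc f) λ′))

  goodBlocks : ℕ → ℕ → ℕ → ℕ → List (List ℕ)
  goodBlocks j p X zero    = []
  goodBlocks j p X (suc k) = segment (fsize i j p) X ∷ goodBlocks (suc j) (lastOr0 (segment (fsize i j p) X)) (X ∸ fsize i j p) k

  goodBlocks-length : ∀ j p X k → length (goodBlocks j p X k) ≡ k
  goodBlocks-length j p X zero    = refl
  goodBlocks-length j p X (suc k) = cong suc (goodBlocks-length (suc j) _ _ k)

  goodBlocks-from-0 : ∀ j X k → ValidBlocks i j 0 (goodBlocks j 0 X k) × concat (goodBlocks j 0 X k) ≡ []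
  goodBlocks-from-0 j X zero    = _ , refl
  goodBlocks-from-0 j X (suc k) rewrite fsize-0 i j with goodBlocks-from-0 (suc j) X k
  ... | valid , concat≡[] = (refl , valid) , concat≡[]

  drop-segment : ∀ f X → suc f ≤ X → drop f (drop (X ∸ suc f) λ′) ≡ drop (X ∸ 1) λ′
  drop-segment f X f<X = trans (drop-drop (X ∸ suc f) f λ′) (cong (λ n → drop n λ′) (∸-suc-+ f<X))

  segment-length : ∀ f X → suc f ≤ X → X ≤ s → length (segment f X) ≡ f
  segment-length f X f<X X≤s = begin
    length (segment f X)  ≡⟨ length-reverse (take f D) ⟩
    length (take f D)     ≡⟨ length-take f D ⟩
    f ⊓ length D          ≡⟨ m≤n⇒m⊓n≡m f≤|D| ⟩
    f                     ∎
    where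
    open ≡-Reasoning
    D : List ℕ
    D = drop (X ∸ suc f) λ′
    f≤|D| : f ≤ length D
    f≤|D| = subst (f ≤_) (sym (length-drop (X ∸ suc f) λ′)) (m+n≤o⇒m≤o∸n f
      (≤-trans (≤-reflexive (trans (+-comm f _) (∸-suc-+ f<X))) (≤-trans (m∸n≤m X 1) X≤s)))

  lastOr0-segment : ∀ f X → suc (suc f) ≤ X → lastOr0 (segment (suc f) X) ≡ part λ′ (X ∸ suc f)
  lastOr0-segment f X f<X = begin
    lastOr0 (segment (suc f) X)          ≡⟨ lastOr0-reverse (take (suc f) D) ⟩
    part (take (suc f) D) 1              ≡⟨ head-take-suc f D ⟩
    part D 1                             ≡⟨ part-drop λ′ (X ∸ suc (suc f)) ⟩
    part λ′ (suc (X ∸ suc (suc f)))      ≡⟨ cong (part λ′) (+-∸-assoc 1 f<X) ⟨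
    part λ′ (X ∸ suc f)                  ∎
    where
    open ≡-Reasoning
    D : List ℕ
    D = drop (X ∸ suc (suc f)) λ′

  Realizes : ℕ → ℕ → ℕ → List (List ℕ) → Set
  Realizes j p X bs = ValidBlocks i j p bs × (∀ {ys} → ys ⊆ drop (X ∸ 1) λ′ → reverse (concat bs) ++ ys ⊆ λ′)

  goodBlocks-spec : ∀ k ℓ acc → Good ℓ acc k →
                    Realizes (suc ℓ) (pv ℓ acc) (index ℓ acc) (goodBlocks (suc ℓ) (pv ℓ acc) (index ℓ acc) k)
  goodBlocks-spec zero    ℓ acc _         = tt , λ ys⊆ → ⊆-trans ys⊆ (drop-⊆ (index ℓ acc ∸ 1) λ′)
  goodBlocks-spec (suc k) ℓ acc (1≤v , g) = cons (fsize i (suc ℓ) v) refl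
    where
    v : ℕ
    v = pv ℓ acc
    X : ℕ
    X = index ℓ acc
    rest : ℕ → List (List ℕ)
    rest f = goodBlocks (suc (suc ℓ)) (lastOr0 (segment f X)) (X ∸ f) k

    cons : ∀ f → f ≡ fsize i (suc ℓ) v → Realizes (suc ℓ) v X (segment f X ∷ rest f)
    cons zero f≡ with goodBlocks-from-0 (suc (suc ℓ)) X k
    ... | valid , concat≡[] =
      (f≡ , valid) , λ {ys} ys⊆ → subst (λ c → reverse c ++ ys ⊆ λ′) (sym concat≡[]) (⊆-trans ys⊆ (drop-⊆ (X ∸ 1) λ′))
    cons (suc f) f≡ = (trans (segment-length F X F<X X≤s) f≡ , proj₁ IH) , sublist
      where
      F : ℕ
      F = suc f
      D : List ℕ
      D = drop (X ∸ suc F) λ′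
      idx′≡ : X ∸ F ≡ index (suc ℓ) (acc + v)
      idx′≡ = trans (cong (X ∸_) f≡) (sym (index-suc ℓ acc 1≤v))
      F<X : suc F ≤ X
      F<X = m∸n≢0⇒n<m λ X∸F≡0 →
        contradiction (subst (1 ≤_) (trans (sym idx′≡) X∸F≡0) (good-index (suc ℓ) (acc + v) k g)) λ ()
      X≤s : X ≤ s
      X≤s = proj₂ (part-positive⇒index λ′ X 1≤v)
      IH : Realizes (suc (suc ℓ)) (lastOr0 (segment F X)) (X ∸ F) (rest F)
      IH = subst₂ (λ p′ X′ → Realizes (suc (suc ℓ)) p′ X′ (goodBlocks (suc (suc ℓ)) p′ X′ k))
             (sym (trans (lastOr0-segment f X F<X) (cong (part λ′) idx′≡))) (sym idx′≡) (goodBlocks-spec k (suc ℓ) (acc + v) g)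
      sublist : ∀ {ys} → ys ⊆ drop (X ∸ 1) λ′ → reverse (concat (segment F X ∷ rest F)) ++ ys ⊆ λ′
      sublist {ys} ys⊆ = subst (_⊆ λ′) (sym (reverse-reverse-++ (take F D) (concat (rest F)) ys))
        (proj₂ IH (subst (λ n → take F D ++ ys ⊆ drop n λ′) (trans (cong (X ∸_) (+-comm 1 F)) (sym (∸-+-assoc X F 1)))
          (take-++-⊆ F D (subst (ys ⊆_) (sym (drop-segment F X F<X)) ys⊆))))

  good⇒inIdeal : ∀ {r} → 1 ≤ i → IsPartition λ′ → Good 1 0 (r ∸ 1) → InIdeal r i λ′
  good⇒inIdeal {r} 1≤i ip g =
    blocks-inIdeal {r} {i} n rest ip (goodBlocks-length 2 n X (r ∸ 1)) (proj₁ spec)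
      (subst (_⊆ λ′) (sym (unfold-reverse n (concat rest))) (proj₂ spec (part-⊆-drop λ′ 1≤X X≤s)))
    where
    n : ℕ
    n = pv 1 0
    X : ℕ
    X = index 1 0
    rest : List (List ℕ)
    rest = goodBlocks 2 n X (r ∸ 1)
    spec : Realizes 2 n X rest
    spec = goodBlocks-spec (r ∸ 1) 1 0 g
    1≤X : 1 ≤ X
    1≤X = good-index 1 0 (r ∸ 1) g
    X≤s : X ≤ s
    X≤s = ≤-reflexive (index-1-0 1≤i)

count-ones : ∀ i → count isOne (replicate i 1) ≡ i
count-ones zero    = refl
count-ones (suc i) = cong suc (count-ones i)

inIdeal-cases : ∀ {r i λ′} → InIdeal r i λ′ →
  i ≤ count isOne λ′ ⊎ ∃[ bs ] (IsBlockGenerator r i bs × All (λ b → 0 < length b) bs × concat bs ≼ λ′)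
inIdeal-cases {i = i} {λ′} (inj₁ x₁ⁱ∣λ) =
  inj₁ (subst (_≤ count isOne λ′) (count-ones i) (count-≤ (∣ₘ⇒≼ x₁ⁱ∣λ) isOne))
inIdeal-cases {r} (inj₂ (bs , gen , bs∣λ)) with All.all? (λ b → 0 <? length b) bs
... | yes nonempty = inj₂ (bs , gen , nonempty , ∣ₘ⇒≼ bs∣λ)
... | no  notAll   = inj₁ (≤-trans (emptyBlock⇒manyOnes {r} gen notAll) (count-≤ (∣ₘ⇒≼ bs∣λ) isOne))

module Characterisation {r i : ℕ} {λ′ : List ℕ}
                        (1≤r : 1 ≤ r) (1≤i : 1 ≤ i) (i≤r : i ≤ r) (ip : IsPartition λ′) where

  open PSequence λ′ i using (good⇒inIdeal; divisor⇒good; good⇒¬exhausted; good⊎exhausted; exhausted⇔C₂)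

  λ↓ : AllPairs _≥_ λ′
  λ↓ = partition-descending ip

  ¬inIdeal⇒InD : ¬ InIdeal r i λ′ → InD r i λ′
  ¬inIdeal⇒InD ¬I with muSeq r i λ′ (r ∸ 1) in μ≡
  ... | []     = refl
  ... | _ ∷ _  = contradiction (nonempty-muSeq⇒inIdeal {r} {i} 1≤r ip μ≡) ¬I

  InD⇒¬inIdeal : InD r i λ′ → ¬ InIdeal r i λ′
  InD⇒¬inIdeal D I with inIdeal-cases {r} {i} I
  ... | inj₁ i≤ones                        = <⇒≱ (ones-bound {r} 1≤i i≤r λ↓ D) i≤ones
  ... | inj₂ (_ , gen , nonempty , bs≼λ) = InD⇒¬divisor {r} 1≤r λ↓ D gen nonempty bs≼λ

  InC⇒¬inIdeal : InC r i λ′ → ¬ InIdeal r i λ′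
  InC⇒¬inIdeal (ones<i , C₂) I with inIdeal-cases {r} {i} I
  ... | inj₁ i≤ones                        = <⇒≱ ones<i i≤ones
  ... | inj₂ (_ , gen , nonempty , bs≼λ) =
    good⇒¬exhausted 1 0 (r ∸ 1) (divisor⇒good λ↓ (proj₂ ip) {r} 1≤i gen nonempty bs≼λ)
      (Equivalence.from (exhausted⇔C₂ {r} 1≤r) C₂)

  InD⇒InC : InD r i λ′ → InC r i λ′
  InD⇒InC D with good⊎exhausted 1 0 (r ∸ 1)
  ... | inj₁ good      = contradiction (good⇒inIdeal {r} 1≤i ip good) (InD⇒¬inIdeal D)
  ... | inj₂ exhausted = ones-bound {r} 1≤i i≤r λ↓ D , Equivalence.to (exhausted⇔C₂ {r} 1≤r) exhausted

theorem4p1 : (r i : ℕ) → 2 ≤ r → 1 ≤ i → i ≤ r → (λ′ : List ℕ) → IsPartition λ′ →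
    ((¬ InIdeal r i λ′) ⇔ InD r i λ′) × (InC r i λ′ ⇔ InD r i λ′)
theorem4p1 r i 2≤r 1≤i i≤r λ′ ip =
  mk⇔ ¬inIdeal⇒InD InD⇒¬inIdeal , mk⇔ (¬inIdeal⇒InD ∘ InC⇒¬inIdeal) InD⇒InC
  where open Characterisation (≤-trans (s≤s z≤n) 2≤r) 1≤i i≤r ip
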